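{- Work in the class language $LL$ with the axioms of extensionality and impredicative comprehension. Let $\Phi$ be a global deterministic system of rules. Then the class $I=\{x\mid \exists a\,(\Phi:a\vdash x \text{ and } x\notin a)\}$ is a paradoxical class; indeed for every set $s\subseteq I$ there is $x$ with $\Phi:s\vdash x$ and $x\in I\setminus s$.
   Context: In $LL$ objects are classes; a class is a set iff it is an element of some class, otherwise it is a paradoxical (proper) class; lower-case variables range over sets. A system of rules is a class $\Phi$ of ordered pairs $(s,x)$ of sets; write $\Phi:s\vdash x$ for $(s,x)\in\Phi$. $\Phi$ is deterministic if $\Phi:s_1\vdash x$ and $\Phi:s_2\vdash x$ imply $s_1=s_2$; $\Phi$ is global if for every set $s$ there is $x$ with $\Phi:s\vdash x$. -}

module Defs where

open import Data.Product using (Σ; Σ-syntax; _×_; _,_; proj₁)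
open import Data.Sum using (_⊎_)
open import Relation.Nullary using (¬_)
open import Relation.Binary.PropositionalEquality using (_≡_)

-- Comprehension is granted for every (Agda-definable) predicate on classes;
-- the members of the comprehension class are exactly the SETS satisfying it.
record LL : Set₁ where
  field
    Class : Set
    _∈_   : Class → Class → Set

  IsSet : Class → Set
  IsSet x = Σ[ y ∈ Class ] (x ∈ y)

  field
    extensionality : (a b : Class) →
      (∀ z → z ∈ a → z ∈ b) → (∀ z → z ∈ b → z ∈ a) → a ≡ b
    comprehension : (P : Class → Set) →
      Σ[ c ∈ Class ] (∀ x → (x ∈ c → IsSet x × P x) × (IsSet x × P x → x ∈ c))

module Classes (L : LL) where
  open LL L public

  _∉_ : Class → Class → Set
  x ∉ y = ¬ (x ∈ y)

  ⟦_⟧ : (Class → Set) → Class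
  ⟦ P ⟧ = proj₁ (comprehension P)

  Paradoxical : Class → Set
  Paradoxical X = ¬ IsSet X

  _⊆_ : Class → Class → Set
  a ⊆ b = ∀ z → z ∈ a → z ∈ b

  upair : Class → Class → Class
  upair a b = ⟦ (λ y → (y ≡ a) ⊎ (y ≡ b)) ⟧

  pair : Class → Class → Class
  pair a b = upair (upair a a) (upair a b)

  IsSystemOfRules : Class → Set
  IsSystemOfRules Φ = ∀ z → z ∈ Φ →
    Σ[ s ∈ Class ] Σ[ x ∈ Class ] (IsSet s × IsSet x × z ≡ pair s x)

  _∶_⊢_ : Class → Class → Class → Set
  Φ ∶ s ⊢ x = pair s x ∈ Φ

  Deterministic : Class → Set
  Deterministic Φ = ∀ s₁ s₂ x → IsSet s₁ → IsSet s₂ → IsSet x →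
    Φ ∶ s₁ ⊢ x → Φ ∶ s₂ ⊢ x → s₁ ≡ s₂

  Global : Class → Set
  Global Φ = ∀ s → IsSet s → Σ[ x ∈ Class ] (IsSet x × Φ ∶ s ⊢ x)

  Icl : Class → Class
  Icl Φ = ⟦ (λ x → Σ[ a ∈ Class ] (IsSet a × Φ ∶ a ⊢ x × x ∉ a)) ⟧

{-# OPTIONS --safe #-}
-- Diagonal argument. If Φ : s ⊢ x with s ⊆ I and x ∈ s, then x ∈ I is witnessed by
-- some a with Φ : a ⊢ x and x ∉ a; determinism forces a = s, contradicting x ∈ s.
-- Hence the conclusion x of any set s ⊆ I lies in I ∖ s, and I cannot be a set,
-- since taking s = I would give x ∈ I ∖ I.
module Submission where

open import Defs
open import Data.Product using (Σ; Σ-syntax; _×_; _,_; proj₁; proj₂)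
open import Relation.Binary.PropositionalEquality using (refl)

module _ (L : LL) where
  open Classes L

  ⊆-refl : ∀ {a} → a ⊆ a
  ⊆-refl _ z∈a = z∈a

  escaping⇒paradoxical : ∀ C →
    (∀ s → IsSet s → s ⊆ C → Σ[ x ∈ Class ] (x ∈ C × x ∉ s)) →
    Paradoxical C
  escaping⇒paradoxical C escape C-set with escape C C-set ⊆-refl
  ... | x , x∈C , x∉C = x∉C x∈C

  module _ {Φ : Class} where
    private
      Produced : Class → Set
      Produced x = Σ[ a ∈ Class ] (IsSet a × Φ ∶ a ⊢ x × x ∉ a)

    ∈Icl⇒produced : ∀ {x} → x ∈ Icl Φ → Produced x
    ∈Icl⇒produced {x} x∈I = proj₂ (proj₁ (proj₂ (comprehension Produced) x) x∈I)

    produced⇒∈Icl : ∀ {x a} → IsSet x → IsSet a → Φ ∶ a ⊢ x → x ∉ a → x ∈ Icl Φ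
    produced⇒∈Icl {x} {a} x-set a-set a⊢x x∉a =
      proj₂ (proj₂ (comprehension Produced) x) (x-set , a , a-set , a⊢x , x∉a)

    module _ (det : Deterministic Φ) {s x : Class}
             (s-set : IsSet s) (x-set : IsSet x) (s⊢x : Φ ∶ s ⊢ x)
             (s⊆I : s ⊆ Icl Φ) where

      conclusion-∉ : x ∉ s
      conclusion-∉ x∈s with ∈Icl⇒produced (s⊆I x x∈s)
      ... | a , a-set , a⊢x , x∉a with det a s x a-set s-set x-set a⊢x s⊢x
      ... | refl = x∉a x∈s

      conclusion-∈Icl : x ∈ Icl Φ
      conclusion-∈Icl = produced⇒∈Icl x-set s-set s⊢x conclusion-∉

mainTheorem7 : (L : LL) → let open Classes L in
    (Φ : Class) → IsSystemOfRules Φ → Global Φ → Deterministic Φ →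
    Paradoxical (Icl Φ) ×
    (∀ s → IsSet s → s ⊆ Icl Φ →
    Σ[ x ∈ Class ] (IsSet x × Φ ∶ s ⊢ x × x ∈ Icl Φ × x ∉ s))
mainTheorem7 L Φ _ global det =
  escaping⇒paradoxical L (Icl Φ) (λ s s-set s⊆I →
    let (x , _ , _ , x∈I , x∉s) = new-conclusion s s-set s⊆I in x , x∈I , x∉s)
  , new-conclusion
  where
  open Classes L
  new-conclusion : ∀ s → IsSet s → s ⊆ Icl Φ →
    Σ[ x ∈ Class ] (IsSet x × Φ ∶ s ⊢ x × x ∈ Icl Φ × x ∉ s)
  new-conclusion s s-set s⊆I with global s s-set
  ... | x , x-set , s⊢x =
    x , x-set , s⊢x
    , conclusion-∈Icl L det s-set x-set s⊢x s⊆I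
    , conclusion-∉ L det s-set x-set s⊢x s⊆I
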